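{- For every $n\ge0$ and $0\le p\le n$, with $S_n=F_nU_n^{ -1}$, $$S_nx^p=\frac{(n+p)!\,(n-p)!}{n!}\sum_{m=p}^{n}\binom{n}{m-p}\binom{n}{n-m}x^m .$$
   Context: Polynomials over $\mathbb{C}$; $(y)_p=y(y-1)\cdots(y-p+1)$, $[y]_k=y(y+1)\cdots(y+k-1)$. On polynomials of degree at most $n$: $U_n^{ -1}x^p=(x)_p[x+1]_{n-p}$ (inverse of $U_nx^p=\frac{(1-x)^{n+1}}{n!}\sum_{m\ge0}m^px^m$, $0^0=1$) and $F_nx^p=(1-x)^{2n+1}\sum_{m\ge0}m^p\binom{m+n}{n}x^m$. -}

module Defs where

open import Data.Nat as ℕ using (ℕ; zero; suc; _≤ᵇ_)
open import Data.Nat.Combinatorics using (_C_)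
open import Data.Nat using (_!)
open import Data.Integer using (ℤ; +_; -_; _+_; _*_; _-_; -1ℤ; 0ℤ; 1ℤ; _^_)
open import Data.List using (List; []; _∷_; map)
open import Data.Bool using (if_then_else_; _∧_)

-- Polynomials over ℤ ⊂ ℂ as coefficient lists, lowest degree first.
Poly : Set
Poly = List ℤ

coeff : Poly → ℕ → ℤ
coeff []       _       = 0ℤ
coeff (a ∷ _)  zero    = a
coeff (_ ∷ as) (suc k) = coeff as k

_⊕_ : Poly → Poly → Poly
[] ⊕ q = q
p ⊕ [] = p
(a ∷ p) ⊕ (b ∷ q) = (a + b) ∷ (p ⊕ q)

scale : ℤ → Poly → Poly
scale c = map (c *_)

_⊛_ : Poly → Poly → Poly
[] ⊛ q = []
(a ∷ p) ⊛ q = scale a q ⊕ (0ℤ ∷ (p ⊛ q))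

xPlus : ℤ → Poly
xPlus c = c ∷ 1ℤ ∷ []

falling : ℕ → Poly
falling zero    = 1ℤ ∷ []
falling (suc p) = falling p ⊛ xPlus (- (+ p))

risingX1 : ℕ → Poly
risingX1 zero    = 1ℤ ∷ []
risingX1 (suc k) = risingX1 k ⊛ xPlus (+ (suc k))

-- U_n^{-1} x^p = (x)_p [x+1]_{n-p}
Uinv : ℕ → ℕ → Poly
Uinv n p = falling p ⊛ risingX1 (n ℕ.∸ p)

sumTo : ℕ → (ℕ → ℤ) → ℤ
sumTo zero    f = 0ℤ
sumTo (suc n) f = sumTo n f + f n

-- coefficient of x^k in the formal power series
--   F_n x^q = (1-x)^{2n+1} Σ_{m≥0} m^q C(m+n,n) x^m
-- (Cauchy product; natural-number power, so 0^0 = 1)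
Fmono : ℕ → ℕ → ℕ → ℤ
Fmono n q k =
  sumTo (suc k) λ j →
    (-1ℤ ^ j) * (+ ((2 ℕ.* n ℕ.+ 1) C j))
      * (+ (((k ℕ.∸ j) ℕ.^ q) ℕ.* (((k ℕ.∸ j) ℕ.+ n) C n)))

Fcoeff : ℕ → Poly → ℕ → ℤ
Fcoeff n P k = go 0 P
  where
  go : ℕ → Poly → ℤ
  go q []       = 0ℤ
  go q (c ∷ cs) = c * Fmono n q k + go (suc q) cs

Scoeff : ℕ → ℕ → ℕ → ℤ
Scoeff n p k = Fcoeff n (Uinv n p) k

rhsCoeff : ℕ → ℕ → ℕ → ℤ
rhsCoeff n p k =
  if (p ≤ᵇ k) ∧ (k ≤ᵇ n)
  then + ((n C (k ℕ.∸ p)) ℕ.* (n C (n ℕ.∸ k)))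
  else 0ℤ

-- At x = m the polynomial U_n⁻¹ x^p = (x)_p [x+1]_(n-p) takes the value n! C(m+n-p, n), so
-- F_n U_n⁻¹ x^p is (1-x)^(2n+1) times the series with coefficients n! C(m+n-p, n) C(m+n, n).
-- With v = m+n-p this product of binomials expands as
--   C(v+p, n) C(v, n) = Σ_i C(n-p, i) C(n+p, n-i) C(v+n-i, 2n),
-- a case of an identity for C(v+p, n) C(v, m') proved by induction on v with Pascal's rule.
-- Since Σ_m C(m+2n-s, 2n) x^m = x^s / (1-x)^(2n+1), the factor (1-x)^(2n+1) cancels, leaving
-- S_n x^p = n! Σ_i C(n-p, i) C(n+p, n-i) x^(p+i); the stated coefficients follow by expanding
-- both sides into factorials.

module Submission where

open import Algebra.Bundles using (CommutativeSemiring)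
open import Data.Nat.Base using (ℕ; zero; suc; _<_)
open import Data.Nat.Properties using (m<n⇒m<1+n; n<1+n)
open import Function using (_∘_)

module FiniteSum {c ℓ} (R : CommutativeSemiring c ℓ) where
  open CommutativeSemiring R renaming (refl to ≈-refl; sym to ≈-sym; trans to ≈-trans)
  open import Relation.Binary.Reasoning.Setoid setoid
  open import Algebra.Properties.CommutativeSemigroup +-commutativeSemigroup
    using (interchange)

  ∑ : ℕ → (ℕ → Carrier) → Carrier
  ∑ zero    f = 0#
  ∑ (suc n) f = ∑ n f + f n

  syntax ∑ n (λ i → e) = ∑[ i < n ] e

  ∑-cong : ∀ n {f g : ℕ → Carrier} → (∀ {i} → i < n → f i ≈ g i) → ∑ n f ≈ ∑ n g
  ∑-cong zero    f≈g = ≈-refl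
  ∑-cong (suc n) f≈g = +-cong (∑-cong n (f≈g ∘ m<n⇒m<1+n)) (f≈g (n<1+n n))

  ∑-zero : ∀ n {f : ℕ → Carrier} → (∀ {i} → i < n → f i ≈ 0#) → ∑ n f ≈ 0#
  ∑-zero zero    f≈0 = ≈-refl
  ∑-zero (suc n) f≈0 = begin
    ∑ n _ + _ ≈⟨ +-cong (∑-zero n (f≈0 ∘ m<n⇒m<1+n)) (f≈0 (n<1+n n)) ⟩
    0# + 0#   ≈⟨ +-identityˡ 0# ⟩
    0#        ∎

  ∑-+ : ∀ n (f g : ℕ → Carrier) → ∑[ i < n ] (f i + g i) ≈ ∑ n f + ∑ n g
  ∑-+ zero    f g = ≈-sym (+-identityˡ 0#)
  ∑-+ (suc n) f g = begin
    ∑[ i < n ] (f i + g i) + (f n + g n) ≈⟨ +-congʳ (∑-+ n f g) ⟩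
    (∑ n f + ∑ n g) + (f n + g n)        ≈⟨ interchange _ _ _ _ ⟩
    (∑ n f + f n) + (∑ n g + g n)        ∎

  ∑-*ˡ : ∀ n a (f : ℕ → Carrier) → ∑[ i < n ] (a * f i) ≈ a * ∑ n f
  ∑-*ˡ zero    a f = ≈-sym (zeroʳ a)
  ∑-*ˡ (suc n) a f = begin
    ∑[ i < n ] (a * f i) + a * f n ≈⟨ +-congʳ (∑-*ˡ n a f) ⟩
    a * ∑ n f + a * f n            ≈⟨ ≈-sym (distribˡ a (∑ n f) (f n)) ⟩
    a * (∑ n f + f n)              ∎

  ∑-head : ∀ n (f : ℕ → Carrier) → ∑ (suc n) f ≈ f 0 + ∑ n (f ∘ suc)
  ∑-head zero    f = ≈-trans (+-identityˡ (f 0)) (≈-sym (+-identityʳ (f 0)))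
  ∑-head (suc n) f = begin
    ∑ (suc n) f + f (suc n)             ≈⟨ +-congʳ (∑-head n f) ⟩
    (f 0 + ∑ n (f ∘ suc)) + f (suc n)   ≈⟨ +-assoc _ _ _ ⟩
    f 0 + (∑ n (f ∘ suc) + f (suc n))   ∎

  ∑-comm : ∀ m n (F : ℕ → ℕ → Carrier) →
           ∑[ i < m ] ∑ n (F i) ≈ ∑[ j < n ] ∑[ i < m ] F i j
  ∑-comm zero    n F = ≈-sym (∑-zero n (λ _ → ≈-refl))
  ∑-comm (suc m) n F = begin
    ∑[ i < m ] ∑ n (F i) + ∑ n (F m)        ≈⟨ +-congʳ (∑-comm m n F) ⟩
    ∑[ j < n ] ∑[ i < m ] F i j + ∑ n (F m) ≈⟨ ≈-sym (∑-+ n _ (F m)) ⟩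
    ∑[ j < n ] (∑[ i < m ] F i j + F m j)   ∎

open import Defs
open import Data.Nat using (ℕ; _≤_; _∸_) renaming (_+_ to _+ℕ_; _*_ to _*ℕ_)
open import Data.Nat using (_!)
open import Data.Integer using (+_; _*_)
open import Relation.Binary.PropositionalEquality using (_≡_)

open import Data.Bool.Properties using (∧-zeroʳ)
open import Data.Integer using (ℤ; 0ℤ; 1ℤ; -1ℤ; _+_; _-_; -_; _^_; _⊖_)
import Data.Integer.Properties as ℤ
import Data.Integer.Tactic.RingSolver as ℤ-Ring
open import Data.List using ([]; _∷_)
open import Data.Nat using (s≤s; _≤ᵇ_) renaming (_^_ to _^ℕ_)
open import Data.Nat.Combinatorics
  using (_C_; nCk+nC[k+1]≡[n+1]C[k+1]; nCk≡n!/k![n-k]!; k>n⇒nCk≡0; k![n∸k]!∣n!; nCn≡1)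
open import Data.Nat.Combinatorics.Base using (_P′_)
open import Data.Nat.Combinatorics.Specification using (nP′k≡n!/[n∸k]!; nP′k≡n[n∸1P′k∸1])
open import Data.Nat.DivMod using (_/_; m/n*n≡m)
open import Data.Nat.Divisibility using (m≤n⇒m!∣n!)
import Data.Nat.Properties as ℕ
import Data.Nat.Tactic.RingSolver as ℕ-Ring
open import Data.Product using (_,_)
open import Data.Sum using (inj₁; inj₂)
open import Relation.Binary.PropositionalEquality
  using (refl; sym; trans; cong; cong₂; subst; _≗_; module ≡-Reasoning)
open import Relation.Nullary using (Dec; yes; no; ¬_)
open import Relation.Nullary.Decidable using (dec-true; dec-false)
open import Algebra.Properties.CommutativeSemigroup ℕ.*-commutativeSemigroup using (x∙yz≈y∙xz)
open import Algebra.Properties.Ring ℤ.+-*-ring using ([y-z]x≈yx-zx; x[y-z]≈xy-xz)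

module ℕΣ = FiniteSum ℕ.+-*-commutativeSemiring
module ℤΣ = FiniteSum ℤ.+-*-commutativeSemiring

-- Binomial coefficients and falling factorials

[n+1]C[k+1]≡nCk+nC[k+1] : ∀ n k → (suc n C suc k) ≡ (n C k) +ℕ (n C suc k)
[n+1]C[k+1]≡nCk+nC[k+1] n k = sym (nCk+nC[k+1]≡[n+1]C[k+1] n k)

nCk*k!*[n∸k]!≡n! : ∀ {n k} → k ≤ n → (n C k) *ℕ (k ! *ℕ (n ∸ k) !) ≡ n !
nCk*k!*[n∸k]!≡n! {n} {k} k≤n = begin
  (n C k) *ℕ (k ! *ℕ (n ∸ k) !)                      ≡⟨ cong (_*ℕ (k ! *ℕ (n ∸ k) !)) (nCk≡n!/k![n-k]! k≤n) ⟩
  n ! / (k ! *ℕ (n ∸ k) !) *ℕ (k ! *ℕ (n ∸ k) !)  ≡⟨ m/n*n≡m (k![n∸k]!∣n! k≤n) ⟩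
  n !                                              ∎
  where
  open ≡-Reasoning
  instance _ = ℕ._!*_!≢0 k (n ∸ k)

nCk*k!*l!≡n! : ∀ k l {n} → k +ℕ l ≡ n → (n C k) *ℕ (k ! *ℕ l !) ≡ n !
nCk*k!*l!≡n! k l refl =
  subst (λ j → ((k +ℕ l) C k) *ℕ (k ! *ℕ j !) ≡ (k +ℕ l) !) (ℕ.m+n∸m≡n k l)
        (nCk*k!*[n∸k]!≡n! (ℕ.m≤m+n k l))

trinomial-revision : ∀ v m n → ((v +ℕ n) C n) *ℕ (v C m) ≡ ((m +ℕ n) C n) *ℕ ((v +ℕ n) C (m +ℕ n))
trinomial-revision v m n with m ℕ.≤? v
... | no m≰v = begin
  ((v +ℕ n) C n) *ℕ (v C m)                ≡⟨ cong (((v +ℕ n) C n) *ℕ_) (k>n⇒nCk≡0 v<m) ⟩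
  ((v +ℕ n) C n) *ℕ 0                      ≡⟨ ℕ.*-zeroʳ ((v +ℕ n) C n) ⟩
  0                                        ≡⟨ ℕ.*-zeroʳ ((m +ℕ n) C n) ⟨
  ((m +ℕ n) C n) *ℕ 0                      ≡⟨ cong (((m +ℕ n) C n) *ℕ_) (k>n⇒nCk≡0 (ℕ.+-monoˡ-< n v<m)) ⟨
  ((m +ℕ n) C n) *ℕ ((v +ℕ n) C (m +ℕ n))  ∎
  where
  open ≡-Reasoning
  v<m = ℕ.≰⇒> m≰v
... | yes m≤v with ℕ.m≤n⇒∃[o]m+o≡n m≤v
... | l , refl = ℕ.*-cancelʳ-≡ _ _ (n ! *ℕ (m ! *ℕ l !)) (trans lhs (sym rhs))
  where
  open ≡-Reasoning
  instance _ = ℕ.m*n≢0 (n !) (m ! *ℕ l !) {{ℕ._!≢0 n}} {{ℕ._!*_!≢0 m l}}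
  N = m +ℕ l +ℕ n
  regroupˡ : ∀ x y a b c → x *ℕ y *ℕ (a *ℕ (b *ℕ c)) ≡ x *ℕ (a *ℕ (y *ℕ (b *ℕ c)))
  regroupˡ = ℕ-Ring.solve-∀
  regroupʳ : ∀ x y a b c → x *ℕ y *ℕ (a *ℕ (b *ℕ c)) ≡ y *ℕ (x *ℕ (a *ℕ b) *ℕ c)
  regroupʳ = ℕ-Ring.solve-∀
  swapʳ : ∀ a b c → a +ℕ b +ℕ c ≡ a +ℕ c +ℕ b
  swapʳ = ℕ-Ring.solve-∀
  lhs : (N C n) *ℕ ((m +ℕ l) C m) *ℕ (n ! *ℕ (m ! *ℕ l !)) ≡ N !
  lhs = begin
    (N C n) *ℕ ((m +ℕ l) C m) *ℕ (n ! *ℕ (m ! *ℕ l !))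
      ≡⟨ regroupˡ (N C n) ((m +ℕ l) C m) (n !) (m !) (l !) ⟩
    (N C n) *ℕ (n ! *ℕ (((m +ℕ l) C m) *ℕ (m ! *ℕ l !)))
      ≡⟨ cong (λ x → (N C n) *ℕ (n ! *ℕ x)) (nCk*k!*l!≡n! m l refl) ⟩
    (N C n) *ℕ (n ! *ℕ (m +ℕ l) !)
      ≡⟨ nCk*k!*l!≡n! n (m +ℕ l) (ℕ.+-comm n (m +ℕ l)) ⟩
    N ! ∎
  rhs : ((m +ℕ n) C n) *ℕ (N C (m +ℕ n)) *ℕ (n ! *ℕ (m ! *ℕ l !)) ≡ N !
  rhs = begin
    ((m +ℕ n) C n) *ℕ (N C (m +ℕ n)) *ℕ (n ! *ℕ (m ! *ℕ l !))
      ≡⟨ regroupʳ ((m +ℕ n) C n) (N C (m +ℕ n)) (n !) (m !) (l !) ⟩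
    (N C (m +ℕ n)) *ℕ (((m +ℕ n) C n) *ℕ (n ! *ℕ m !) *ℕ l !)
      ≡⟨ cong (λ x → (N C (m +ℕ n)) *ℕ (x *ℕ l !)) (nCk*k!*l!≡n! n m (ℕ.+-comm n m)) ⟩
    (N C (m +ℕ n)) *ℕ ((m +ℕ n) ! *ℕ l !)
      ≡⟨ nCk*k!*l!≡n! (m +ℕ n) l (swapʳ m n l) ⟩
    N ! ∎

m∸n≡1+[m∸1+n] : ∀ {m n} → n < m → m ∸ n ≡ suc (m ∸ suc n)
m∸n≡1+[m∸1+n] n<m = ℕ.+-∸-assoc 1 n<m

k>n⇒nP′k≡0 : ∀ {n k} → n < k → n P′ k ≡ 0
k>n⇒nP′k≡0 {n} {suc k} n<1+k with ℕ.m<1+n⇒m<n∨m≡n n<1+k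
... | inj₁ n<k  = trans (cong ((n ∸ k) *ℕ_) (k>n⇒nP′k≡0 n<k)) (ℕ.*-zeroʳ (n ∸ k))
... | inj₂ refl = cong (_*ℕ (n P′ n)) (ℕ.n∸n≡0 n)

nP′k*[n∸k]!≡n! : ∀ {n k} → k ≤ n → (n P′ k) *ℕ (n ∸ k) ! ≡ n !
nP′k*[n∸k]!≡n! {n} {k} k≤n =
  trans (cong (_*ℕ (n ∸ k) !) (nP′k≡n!/[n∸k]! k≤n)) (m/n*n≡m (m≤n⇒m!∣n! (ℕ.m∸n≤m n k)))
  where instance _ = (n ∸ k) ℕ.!≢0

nP′k≡k!*nCk : ∀ n k → n P′ k ≡ k ! *ℕ (n C k)
nP′k≡k!*nCk n k with k ℕ.≤? n
... | yes k≤n = ℕ.*-cancelʳ-≡ _ _ ((n ∸ k) !) (trans (nP′k*[n∸k]!≡n! k≤n) (sym regrouped))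
  where
  instance _ = (n ∸ k) ℕ.!≢0
  regrouped : k ! *ℕ (n C k) *ℕ (n ∸ k) ! ≡ n !
  regrouped = trans (trans (cong (_*ℕ (n ∸ k) !) (ℕ.*-comm (k !) (n C k))) (ℕ.*-assoc (n C k) (k !) ((n ∸ k) !)))
                    (nCk*k!*[n∸k]!≡n! k≤n)
... | no k≰n = trans (k>n⇒nP′k≡0 n<k) (sym (trans (cong (k ! *ℕ_) (k>n⇒nCk≡0 n<k)) (ℕ.*-zeroʳ (k !))))
  where n<k = ℕ.≰⇒> k≰n

nP′[k+l]≡[n∸l]P′k*nP′l : ∀ n k l → n P′ (k +ℕ l) ≡ ((n ∸ l) P′ k) *ℕ (n P′ l)
nP′[k+l]≡[n∸l]P′k*nP′l n zero    l = sym (ℕ.*-identityˡ (n P′ l))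
nP′[k+l]≡[n∸l]P′k*nP′l n (suc k) l = begin
  (n ∸ (k +ℕ l)) *ℕ (n P′ (k +ℕ l))
    ≡⟨ cong₂ _*ℕ_ n∸[k+l]≡n∸l∸k (nP′[k+l]≡[n∸l]P′k*nP′l n k l) ⟩
  (n ∸ l ∸ k) *ℕ (((n ∸ l) P′ k) *ℕ (n P′ l))
    ≡⟨ ℕ.*-assoc (n ∸ l ∸ k) ((n ∸ l) P′ k) (n P′ l) ⟨
  (n ∸ l ∸ k) *ℕ ((n ∸ l) P′ k) *ℕ (n P′ l) ∎
  where
  open ≡-Reasoning
  n∸[k+l]≡n∸l∸k = trans (cong (n ∸_) (ℕ.+-comm k l)) (sym (ℕ.∸-+-assoc n l k))

module BinomialProductExpansion where
  open ℕΣ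

  ∑-pascal : ∀ n b (f : ℕ → ℕ) →
    ∑[ i < suc n ] ((suc b C i) *ℕ f i)
      ≡ ∑[ i < suc n ] ((b C i) *ℕ f i) +ℕ ∑[ i < n ] ((b C i) *ℕ f (suc i))
  ∑-pascal n b f = begin
    ∑[ i < suc n ] ((suc b C i) *ℕ f i)                       ≡⟨ ∑-head n _ ⟩
    1 *ℕ f 0 +ℕ ∑[ i < n ] ((suc b C suc i) *ℕ f (suc i))    ≡⟨ cong (1 *ℕ f 0 +ℕ_) (∑-cong n split) ⟩
    1 *ℕ f 0 +ℕ ∑[ i < n ] (Tail i +ℕ Shifted i)             ≡⟨ cong (1 *ℕ f 0 +ℕ_) (∑-+ n Tail Shifted) ⟩
    1 *ℕ f 0 +ℕ (∑ n Tail +ℕ ∑ n Shifted)                    ≡⟨ ℕ.+-assoc (1 *ℕ f 0) _ _ ⟨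
    1 *ℕ f 0 +ℕ ∑ n Tail +ℕ ∑ n Shifted                      ≡⟨ cong (_+ℕ ∑ n Shifted) (∑-head n _) ⟨
    ∑[ i < suc n ] ((b C i) *ℕ f i) +ℕ ∑ n Shifted           ∎
    where
    open ≡-Reasoning
    Tail Shifted : ℕ → ℕ
    Tail    i = (b C suc i) *ℕ f (suc i)
    Shifted i = (b C i) *ℕ f (suc i)
    split : ∀ {i} → i < n → (suc b C suc i) *ℕ f (suc i) ≡ Tail i +ℕ Shifted i
    split {i} _ = trans (cong (_*ℕ f (suc i)) ([n+1]C[k+1]≡nCk+nC[k+1] b i))
      (trans (ℕ.*-distribʳ-+ (f (suc i)) (b C i) (b C suc i)) (ℕ.+-comm (Shifted i) (Tail i)))

  ∑-pascal-reversed : ∀ n c (f : ℕ → ℕ) →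
    ∑[ i < suc n ] ((suc c C (n ∸ i)) *ℕ f i)
      ≡ ∑[ i < suc n ] ((c C (n ∸ i)) *ℕ f i) +ℕ ∑[ i < n ] ((c C (n ∸ suc i)) *ℕ f i)
  ∑-pascal-reversed n c f = begin
    ∑[ i < n ] ((suc c C (n ∸ i)) *ℕ f i) +ℕ Last (suc c)   ≡⟨ cong₂ _+ℕ_ (∑-cong n split) (last-term) ⟩
    ∑[ i < n ] (Lower i +ℕ Same i) +ℕ Last c                 ≡⟨ cong (_+ℕ Last c) (∑-+ n Lower Same) ⟩
    ∑ n Lower +ℕ ∑ n Same +ℕ Last c                          ≡⟨ rotate (∑ n Lower) (∑ n Same) (Last c) ⟩
    ∑ n Same +ℕ Last c +ℕ ∑ n Lower                          ∎
    where
    open ≡-Reasoning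
    Lower Same : ℕ → ℕ
    Lower i = (c C (n ∸ suc i)) *ℕ f i
    Same  i = (c C (n ∸ i)) *ℕ f i
    Last : ℕ → ℕ
    Last d = (d C (n ∸ n)) *ℕ f n
    last-term : Last (suc c) ≡ Last c
    last-term rewrite ℕ.n∸n≡0 n = refl
    split : ∀ {i} → i < n → (suc c C (n ∸ i)) *ℕ f i ≡ Lower i +ℕ Same i
    split {i} i<n = begin
      (suc c C (n ∸ i)) *ℕ f i
        ≡⟨ cong (λ j → (suc c C j) *ℕ f i) n∸i≡1+[n∸1+i] ⟩
      (suc c C suc (n ∸ suc i)) *ℕ f i
        ≡⟨ cong (_*ℕ f i) ([n+1]C[k+1]≡nCk+nC[k+1] c (n ∸ suc i)) ⟩
      ((c C (n ∸ suc i)) +ℕ (c C suc (n ∸ suc i))) *ℕ f i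
        ≡⟨ cong (λ j → ((c C (n ∸ suc i)) +ℕ (c C j)) *ℕ f i) n∸i≡1+[n∸1+i] ⟨
      ((c C (n ∸ suc i)) +ℕ (c C (n ∸ i))) *ℕ f i
        ≡⟨ ℕ.*-distribʳ-+ (f i) (c C (n ∸ suc i)) (c C (n ∸ i)) ⟩
      Lower i +ℕ Same i ∎
      where n∸i≡1+[n∸1+i] = m∸n≡1+[m∸1+n] i<n
    rotate : ∀ x y z → x +ℕ y +ℕ z ≡ y +ℕ z +ℕ x
    rotate = ℕ-Ring.solve-∀

  expansion : ℕ → ℕ → ℕ → ℕ → ℕ
  expansion p n m v =
    ∑[ i < suc n ] (((n ∸ p) C i) *ℕ (((m +ℕ p) C (n ∸ i)) *ℕ ((v +ℕ (n ∸ i)) C (m +ℕ n))))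

  -- The part of `expansion p n m (suc v)` split off by Pascal's rule in the last factor.
  correction : ℕ → ℕ → ℕ → ℕ → ℕ → ℕ
  correction p n m N v =
    ∑[ i < suc n ] (((n ∸ suc p) C i) *ℕ (((m +ℕ p) C (n ∸ i)) *ℕ ((v +ℕ (n ∸ i)) C N)))

  expansion-suc : ∀ {p n m N} v → p < n → m +ℕ n ≡ suc N →
    expansion p n m (suc v) ≡ expansion (suc p) n m v +ℕ correction p n m N v
  expansion-suc {p} {n} {m} {N} v p<n m+n≡1+N = begin
    expansion p n m (suc v)
      ≡⟨ cong (λ c → ∑[ i < suc n ] ((c C i) *ℕ (a i *ℕ W⁺ i))) (m∸n≡1+[m∸1+n] p<n) ⟩
    ∑[ i < suc n ] ((suc b C i) *ℕ (a i *ℕ W⁺ i))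
      ≡⟨ ∑-pascal n b (λ i → a i *ℕ W⁺ i) ⟩
    ∑[ i < suc n ] ((b C i) *ℕ (a i *ℕ W⁺ i)) +ℕ ∑[ i < n ] ((b C i) *ℕ (a (suc i) *ℕ W⁺ (suc i)))
      ≡⟨ cong₂ _+ℕ_ (trans (∑-cong (suc n) (λ {i} _ → split-W⁺ i)) (∑-+ (suc n) _ _))
                    (∑-cong n (λ {i} i<n → cong (λ w → (b C i) *ℕ (a (suc i) *ℕ w)) (W⁺-shift i<n))) ⟩
    (S₁ +ℕ correction p n m N v) +ℕ S₂
      ≡⟨ swapʳ S₁ _ S₂ ⟩
    (S₁ +ℕ S₂) +ℕ correction p n m N v
      ≡⟨ cong (_+ℕ correction p n m N v) (sym expansion-suc-p) ⟩
    expansion (suc p) n m v +ℕ correction p n m N v ∎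
    where
    open ≡-Reasoning
    b = n ∸ suc p
    a W W′ W⁺ : ℕ → ℕ
    a i  = (m +ℕ p) C (n ∸ i)
    W i  = (v +ℕ (n ∸ i)) C (m +ℕ n)
    W′ i = (v +ℕ (n ∸ i)) C N
    W⁺ i = (suc v +ℕ (n ∸ i)) C (m +ℕ n)
    S₁ = ∑[ i < suc n ] ((b C i) *ℕ (a i *ℕ W i))
    S₂ = ∑[ i < n ] ((b C i) *ℕ (a (suc i) *ℕ W i))
    swapʳ : ∀ x y z → x +ℕ y +ℕ z ≡ x +ℕ z +ℕ y
    swapʳ = ℕ-Ring.solve-∀
    W⁺-pascal : ∀ i → W⁺ i ≡ W i +ℕ W′ i
    W⁺-pascal i = begin
      (suc x C (m +ℕ n))           ≡⟨ cong (suc x C_) m+n≡1+N ⟩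
      (suc x C suc N)              ≡⟨ [n+1]C[k+1]≡nCk+nC[k+1] x N ⟩
      (x C N) +ℕ (x C suc N)       ≡⟨ cong (λ k → (x C N) +ℕ (x C k)) m+n≡1+N ⟨
      W′ i +ℕ W i                  ≡⟨ ℕ.+-comm (W′ i) (W i) ⟩
      W i +ℕ W′ i                  ∎
      where x = v +ℕ (n ∸ i)
    split-W⁺ : ∀ i → (b C i) *ℕ (a i *ℕ W⁺ i) ≡ (b C i) *ℕ (a i *ℕ W i) +ℕ (b C i) *ℕ (a i *ℕ W′ i)
    split-W⁺ i = trans (cong (λ w → (b C i) *ℕ (a i *ℕ w)) (W⁺-pascal i)) (distrib (b C i) (a i) (W i) (W′ i))
      where
      distrib : ∀ x y u w → x *ℕ (y *ℕ (u +ℕ w)) ≡ x *ℕ (y *ℕ u) +ℕ x *ℕ (y *ℕ w)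
      distrib = ℕ-Ring.solve-∀
    W⁺-shift : ∀ {i} → i < n → W⁺ (suc i) ≡ W i
    W⁺-shift {i} i<n = cong (_C (m +ℕ n))
      (trans (sym (ℕ.+-suc v (n ∸ suc i))) (cong (v +ℕ_) (sym (m∸n≡1+[m∸1+n] i<n))))
    expansion-suc-p : expansion (suc p) n m v ≡ S₁ +ℕ S₂
    expansion-suc-p = begin
      expansion (suc p) n m v
        ≡⟨ ∑-cong (suc n) (λ {i} _ → trans (cong (λ k → (b C i) *ℕ ((k C (n ∸ i)) *ℕ W i)) (ℕ.+-suc m p))
                                           (x∙yz≈y∙xz (b C i) (suc (m +ℕ p) C (n ∸ i)) (W i))) ⟩
      ∑[ i < suc n ] ((suc (m +ℕ p) C (n ∸ i)) *ℕ ((b C i) *ℕ W i))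
        ≡⟨ ∑-pascal-reversed n (m +ℕ p) (λ i → (b C i) *ℕ W i) ⟩
      ∑[ i < suc n ] (a i *ℕ ((b C i) *ℕ W i)) +ℕ ∑[ i < n ] (a (suc i) *ℕ ((b C i) *ℕ W i))
        ≡⟨ cong₂ _+ℕ_ (∑-cong (suc n) (λ {i} _ → x∙yz≈y∙xz (a i) (b C i) (W i)))
                      (∑-cong n (λ {i} _ → x∙yz≈y∙xz (a (suc i)) (b C i) (W i))) ⟩
      S₁ +ℕ S₂ ∎

  correction-suc : ∀ p n m v → correction p n (suc m) (m +ℕ n) v ≡ expansion (suc p) n m v
  correction-suc p n m v =
    cong (λ k → ∑[ i < suc n ] (((n ∸ suc p) C i) *ℕ ((k C (n ∸ i)) *ℕ ((v +ℕ (n ∸ i)) C (m +ℕ n)))))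
         (sym (ℕ.+-suc m p))

  correction-zero : ∀ {p n} N v → p < n → correction p n 0 N v ≡ 0
  correction-zero {p} {n} N v p<n = ∑-zero (suc n) (λ {i} _ → vanish i)
    where
    vanish : ∀ i → ((n ∸ suc p) C i) *ℕ ((p C (n ∸ i)) *ℕ ((v +ℕ (n ∸ i)) C N)) ≡ 0
    vanish i with p ℕ.<? n ∸ i
    ... | yes p<n∸i =
      trans (cong (λ c → ((n ∸ suc p) C i) *ℕ (c *ℕ ((v +ℕ (n ∸ i)) C N))) (k>n⇒nCk≡0 p<n∸i))
            (ℕ.*-zeroʳ ((n ∸ suc p) C i))
    ... | no p≮n∸i = cong (_*ℕ ((p C (n ∸ i)) *ℕ ((v +ℕ (n ∸ i)) C N))) (k>n⇒nCk≡0 n∸1+p<i)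
      where
      n≤p+i : n ≤ p +ℕ i
      n≤p+i = ℕ.≤-trans (ℕ.m≤n+m∸n n i)
        (ℕ.≤-trans (ℕ.+-monoʳ-≤ i (ℕ.≮⇒≥ p≮n∸i)) (ℕ.≤-reflexive (ℕ.+-comm i p)))
      n∸1+p<i : n ∸ suc p < i
      n∸1+p<i = subst (_≤ i) (m∸n≡1+[m∸1+n] p<n) (ℕ.m≤n+o⇒m∸n≤o n p n≤p+i)

  expansion-zero : ∀ {p n} m → p < n → expansion p n m 0 ≡ 0
  expansion-zero {p} {n} m p<n = ∑-zero (suc n) (λ {i} _ → vanish i)
    where
    vanish : ∀ i → ((n ∸ p) C i) *ℕ (((m +ℕ p) C (n ∸ i)) *ℕ ((n ∸ i) C (m +ℕ n))) ≡ 0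
    vanish i with n ∸ i ℕ.<? m +ℕ n
    ... | yes n∸i<m+n = trans (cong (λ c → ((n ∸ p) C i) *ℕ (((m +ℕ p) C (n ∸ i)) *ℕ c)) (k>n⇒nCk≡0 n∸i<m+n))
      (trans (cong (((n ∸ p) C i) *ℕ_) (ℕ.*-zeroʳ ((m +ℕ p) C (n ∸ i)))) (ℕ.*-zeroʳ ((n ∸ p) C i)))
    ... | no n∸i≮m+n = trans (cong (λ c → ((n ∸ p) C i) *ℕ (c *ℕ ((n ∸ i) C (m +ℕ n)))) (k>n⇒nCk≡0 m+p<n∸i))
      (ℕ.*-zeroʳ ((n ∸ p) C i))
      where
      m+p<n∸i : m +ℕ p < n ∸ i
      m+p<n∸i = ℕ.<-≤-trans (ℕ.+-monoʳ-< m p<n) (ℕ.≮⇒≥ n∸i≮m+n)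

  expansion-diagonal : ∀ n m v → expansion n n m v ≡ ((m +ℕ n) C n) *ℕ ((v +ℕ n) C (m +ℕ n))
  expansion-diagonal n m v = begin
    expansion n n m v                                  ≡⟨ ∑-head n _ ⟩
    ((n ∸ n) C 0) *ℕ Top +ℕ ∑[ i < n ] (((n ∸ n) C suc i) *ℕ Term i)
      ≡⟨ cong₂ _+ℕ_ (ℕ.*-identityˡ Top) (∑-zero n (λ {i} _ → cong (λ c → (c C suc i) *ℕ Term i) (ℕ.n∸n≡0 n))) ⟩
    Top +ℕ 0                                           ≡⟨ ℕ.+-identityʳ Top ⟩
    Top                                                ∎
    where
    open ≡-Reasoning
    Top = ((m +ℕ n) C n) *ℕ ((v +ℕ n) C (m +ℕ n))
    Term : ℕ → ℕ
    Term i = ((m +ℕ n) C (n ∸ suc i)) *ℕ ((v +ℕ (n ∸ suc i)) C (m +ℕ n))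

  binomial-product-expansion : ∀ v {p n} m → p ≤ n → ((v +ℕ p) C n) *ℕ (v C m) ≡ expansion p n m v
  expansion-below-diagonal : ∀ v {p n} m → p < n → ((v +ℕ p) C n) *ℕ (v C m) ≡ expansion p n m v

  binomial-product-expansion v {p} m p≤n with ℕ.m≤n⇒m<n∨m≡n p≤n
  ... | inj₁ p<n  = expansion-below-diagonal v m p<n
  ... | inj₂ refl = trans (trinomial-revision v m p) (sym (expansion-diagonal p m v))

  expansion-below-diagonal zero {p} {n} m p<n =
    trans (cong (_*ℕ (0 C m)) (k>n⇒nCk≡0 p<n)) (sym (expansion-zero m p<n))
  expansion-below-diagonal (suc v) {p} {suc n} zero p<n = begin
    ((suc v +ℕ p) C suc n) *ℕ 1                     ≡⟨ cong (λ k → (k C suc n) *ℕ 1) (ℕ.+-suc v p) ⟨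
    ((v +ℕ suc p) C suc n) *ℕ (v C 0)               ≡⟨ binomial-product-expansion v 0 p<n ⟩
    expansion (suc p) (suc n) 0 v                   ≡⟨ ℕ.+-identityʳ _ ⟨
    expansion (suc p) (suc n) 0 v +ℕ 0              ≡⟨ cong (expansion (suc p) (suc n) 0 v +ℕ_) (correction-zero n v p<n) ⟨
    expansion (suc p) (suc n) 0 v +ℕ correction p (suc n) 0 n v ≡⟨ expansion-suc v p<n refl ⟨
    expansion p (suc n) 0 (suc v)                   ∎
    where open ≡-Reasoning
  expansion-below-diagonal (suc v) {p} {n} (suc m) p<n = begin
    ((suc v +ℕ p) C n) *ℕ (suc v C suc m)
      ≡⟨ cong (((suc v +ℕ p) C n) *ℕ_) ([n+1]C[k+1]≡nCk+nC[k+1] v m) ⟩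
    ((suc v +ℕ p) C n) *ℕ ((v C m) +ℕ (v C suc m))
      ≡⟨ cong (λ k → (k C n) *ℕ ((v C m) +ℕ (v C suc m))) (ℕ.+-suc v p) ⟨
    ((v +ℕ suc p) C n) *ℕ ((v C m) +ℕ (v C suc m))
      ≡⟨ ℕ.*-distribˡ-+ ((v +ℕ suc p) C n) (v C m) (v C suc m) ⟩
    ((v +ℕ suc p) C n) *ℕ (v C m) +ℕ ((v +ℕ suc p) C n) *ℕ (v C suc m)
      ≡⟨ cong₂ _+ℕ_ (binomial-product-expansion v m p<n) (binomial-product-expansion v (suc m) p<n) ⟩
    expansion (suc p) n m v +ℕ expansion (suc p) n (suc m) v
      ≡⟨ ℕ.+-comm (expansion (suc p) n m v) _ ⟩
    expansion (suc p) n (suc m) v +ℕ expansion (suc p) n m v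
      ≡⟨ cong (expansion (suc p) n (suc m) v +ℕ_) (correction-suc p n m v) ⟨
    expansion (suc p) n (suc m) v +ℕ correction p n (suc m) (m +ℕ n) v
      ≡⟨ expansion-suc v p<n refl ⟨
    expansion p n (suc m) (suc v) ∎
    where open ≡-Reasoning

open ℤΣ

∑-- : ∀ n (f g : ℕ → ℤ) → ∑[ i < n ] (f i - g i) ≡ ∑ n f - ∑ n g
∑-- zero    f g = refl
∑-- (suc n) f g = trans (cong (_+ (f n - g n)) (∑-- n f g)) (regroup (∑ n f) (∑ n g) (f n) (g n))
  where
  regroup : ∀ a b c d → (a - b) + (c - d) ≡ (a + c) - (b + d)
  regroup = ℤ-Ring.solve-∀

+-∑ : ∀ n (f : ℕ → ℕ) → + (ℕΣ.∑ n f) ≡ ∑[ i < n ] (+ f i)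
+-∑ zero    f = refl
+-∑ (suc n) f = trans (ℤ.pos-+ (ℕΣ.∑ n f) (f n)) (cong (_+ + f n) (+-∑ n f))

sumTo≡∑ : ∀ n f → sumTo n f ≡ ∑ n f
sumTo≡∑ zero    f = refl
sumTo≡∑ (suc n) f = cong (_+ f n) (sumTo≡∑ n f)

-- Formal power series

Series : Set
Series = ℕ → ℤ

infixl 7 _⋆_
_⋆_ : Series → Series → Series
(a ⋆ b) k = ∑[ j < suc k ] (a j * b (k ∸ j))

[1-x]·_ : Series → Series
([1-x]· a) zero    = a zero
([1-x]· a) (suc k) = a (suc k) - a k

[1-x]^_ : ℕ → Series
([1-x]^ N) j = (-1ℤ ^ j) * + (N C j)

[1-x]^-[1+_] : ℕ → Series
[1-x]^-[1+ r ] m = + ((m +ℕ r) C r)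

x^_·_ : ℕ → Series → Series
(x^ zero  · a) k       = a k
(x^ suc s · a) zero    = 0ℤ
(x^ suc s · a) (suc k) = (x^ s · a) k

𝟙 : Series
𝟙 zero    = 1ℤ
𝟙 (suc _) = 0ℤ

⋆-congʳ : ∀ a {b c} → b ≗ c → a ⋆ b ≗ a ⋆ c
⋆-congʳ a b≗c k = ∑-cong (suc k) (λ {j} _ → cong (a j *_) (b≗c (k ∸ j)))

⋆-congˡ : ∀ {a b} c → a ≗ b → a ⋆ c ≗ b ⋆ c
⋆-congˡ c a≗b k = ∑-cong (suc k) (λ {j} _ → cong (_* c (k ∸ j)) (a≗b j))

x^-cong : ∀ s {a b} → a ≗ b → x^ s · a ≗ x^ s · b
x^-cong zero    a≗b k       = a≗b k
x^-cong (suc s) a≗b zero    = refl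
x^-cong (suc s) a≗b (suc k) = x^-cong s a≗b k

[1-x]·-⋆ˡ : ∀ a b → ([1-x]· a) ⋆ b ≗ [1-x]· (a ⋆ b)
[1-x]·-⋆ˡ a b zero    = refl
[1-x]·-⋆ˡ a b (suc k) = begin
  (([1-x]· a) ⋆ b) (suc k)
    ≡⟨ ∑-head (suc k) _ ⟩
  a 0 * b (suc k) + ∑[ j < suc k ] ((a (suc j) - a j) * b (k ∸ j))
    ≡⟨ cong (λ t → a 0 * b (suc k) + t)
            (trans (∑-cong (suc k) (λ {j} _ → [y-z]x≈yx-zx (b (k ∸ j)) (a (suc j)) (a j))) (∑-- (suc k) _ _)) ⟩
  a 0 * b (suc k) + (∑[ j < suc k ] (a (suc j) * b (k ∸ j)) - (a ⋆ b) k)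
    ≡⟨ ℤ.+-assoc (a 0 * b (suc k)) _ _ ⟨
  a 0 * b (suc k) + ∑[ j < suc k ] (a (suc j) * b (k ∸ j)) - (a ⋆ b) k
    ≡⟨ cong (_- (a ⋆ b) k) (∑-head (suc k) _) ⟨
  (a ⋆ b) (suc k) - (a ⋆ b) k ∎
  where open ≡-Reasoning

⋆-[1-x]·ʳ : ∀ a b → a ⋆ ([1-x]· b) ≗ [1-x]· (a ⋆ b)
⋆-[1-x]·ʳ a b zero    = refl
⋆-[1-x]·ʳ a b (suc k) = begin
  ∑[ j < suc k ] (a j * ([1-x]· b) (suc k ∸ j)) + a (suc k) * ([1-x]· b) (k ∸ k)
    ≡⟨ cong₂ _+_ (trans (∑-cong (suc k) split) (∑-- (suc k) _ _)) last ⟩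
  (∑[ j < suc k ] (a j * b (suc k ∸ j)) - (a ⋆ b) k) + a (suc k) * b (k ∸ k)
    ≡⟨ swap (∑[ j < suc k ] (a j * b (suc k ∸ j))) ((a ⋆ b) k) (a (suc k) * b (k ∸ k)) ⟩
  (a ⋆ b) (suc k) - (a ⋆ b) k ∎
  where
  open ≡-Reasoning
  split : ∀ {j} → j < suc k → a j * ([1-x]· b) (suc k ∸ j) ≡ a j * b (suc k ∸ j) - a j * b (k ∸ j)
  split {j} (s≤s j≤k) = begin
    a j * ([1-x]· b) (suc k ∸ j)         ≡⟨ cong (λ i → a j * ([1-x]· b) i) 1+k∸j≡1+[k∸j] ⟩
    a j * (b (suc (k ∸ j)) - b (k ∸ j))  ≡⟨ x[y-z]≈xy-xz (a j) (b (suc (k ∸ j))) (b (k ∸ j)) ⟩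
    a j * b (suc (k ∸ j)) - a j * b (k ∸ j) ≡⟨ cong (λ i → a j * b i - a j * b (k ∸ j)) 1+k∸j≡1+[k∸j] ⟨
    a j * b (suc k ∸ j) - a j * b (k ∸ j) ∎
    where 1+k∸j≡1+[k∸j] = ℕ.+-∸-assoc 1 j≤k
  last : a (suc k) * ([1-x]· b) (k ∸ k) ≡ a (suc k) * b (k ∸ k)
  last rewrite ℕ.n∸n≡0 k = refl
  swap : ∀ x y z → (x - y) + z ≡ (x + z) - y
  swap = ℤ-Ring.solve-∀

[1-x]^-suc : ∀ N → [1-x]^ suc N ≗ [1-x]· ([1-x]^ N)
[1-x]^-suc N zero    = refl
[1-x]^-suc N (suc j) = begin
  -1ℤ * s * + (suc N C suc j)               ≡⟨ cong (λ c → -1ℤ * s * + c) ([n+1]C[k+1]≡nCk+nC[k+1] N j) ⟩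
  -1ℤ * s * + ((N C j) +ℕ (N C suc j))      ≡⟨ cong (-1ℤ * s *_) (ℤ.pos-+ (N C j) (N C suc j)) ⟩
  -1ℤ * s * (+ (N C j) + + (N C suc j))     ≡⟨ expand s (+ (N C j)) (+ (N C suc j)) ⟩
  -1ℤ * s * + (N C suc j) - s * + (N C j)   ∎
  where
  open ≡-Reasoning
  s = -1ℤ ^ j
  expand : ∀ s a b → -1ℤ * s * (a + b) ≡ -1ℤ * s * b - s * a
  expand = ℤ-Ring.solve-∀

[1-x]^0-⋆ : ∀ a → [1-x]^ 0 ⋆ a ≗ a
[1-x]^0-⋆ a k = begin
  ([1-x]^ 0 ⋆ a) k                                        ≡⟨ ∑-head k _ ⟩
  + 1 * a k + ∑[ j < k ] (([1-x]^ 0) (suc j) * a (k ∸ suc j)) ≡⟨ cong₂ _+_ (ℤ.*-identityˡ (a k)) (∑-zero k vanish) ⟩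
  a k + 0ℤ                                                ≡⟨ ℤ.+-identityʳ (a k) ⟩
  a k                                                     ∎
  where
  open ≡-Reasoning
  vanish : ∀ {j} → j < k → ([1-x]^ 0) (suc j) * a (k ∸ suc j) ≡ 0ℤ
  vanish {j} _ = cong (_* a (k ∸ suc j)) (ℤ.*-zeroʳ (-1ℤ ^ suc j))

[1-x]^-suc-⋆ : ∀ N a → [1-x]^ suc N ⋆ a ≗ [1-x]^ N ⋆ ([1-x]· a)
[1-x]^-suc-⋆ N a k = begin
  ([1-x]^ suc N ⋆ a) k            ≡⟨ ⋆-congˡ a ([1-x]^-suc N) k ⟩
  (([1-x]· ([1-x]^ N)) ⋆ a) k     ≡⟨ [1-x]·-⋆ˡ ([1-x]^ N) a k ⟩
  ([1-x]· ([1-x]^ N ⋆ a)) k       ≡⟨ ⋆-[1-x]·ʳ ([1-x]^ N) a k ⟨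
  ([1-x]^ N ⋆ ([1-x]· a)) k       ∎
  where open ≡-Reasoning

[1-x]·-x^ : ∀ s a → [1-x]· (x^ s · a) ≗ x^ s · ([1-x]· a)
[1-x]·-x^ zero    a k             = refl
[1-x]·-x^ (suc s) a zero          = refl
[1-x]·-x^ (suc s) a (suc zero)    = trans (ℤ.+-identityʳ ((x^ s · a) 0)) ([1-x]·-x^ s a zero)
[1-x]·-x^ (suc s) a (suc (suc k)) = [1-x]·-x^ s a (suc k)

[1-x]·[1-x]^-[1+suc] : ∀ r → [1-x]· [1-x]^-[1+ suc r ] ≗ [1-x]^-[1+ r ]
[1-x]·[1-x]^-[1+suc] r zero    = cong +_ (trans (nCn≡1 (suc r)) (sym (nCn≡1 r)))
[1-x]·[1-x]^-[1+suc] r (suc m) = begin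
  + ((suc m +ℕ suc r) C suc r) - + ((m +ℕ suc r) C suc r)
    ≡⟨ cong (λ c → + c - + ((m +ℕ suc r) C suc r)) ([n+1]C[k+1]≡nCk+nC[k+1] (m +ℕ suc r) r) ⟩
  + (((m +ℕ suc r) C r) +ℕ ((m +ℕ suc r) C suc r)) - + ((m +ℕ suc r) C suc r)
    ≡⟨ cong (_- + ((m +ℕ suc r) C suc r)) (ℤ.pos-+ ((m +ℕ suc r) C r) _) ⟩
  + ((m +ℕ suc r) C r) + + ((m +ℕ suc r) C suc r) - + ((m +ℕ suc r) C suc r)
    ≡⟨ cancel (+ ((m +ℕ suc r) C r)) (+ ((m +ℕ suc r) C suc r)) ⟩
  + ((m +ℕ suc r) C r)
    ≡⟨ cong (λ t → + (t C r)) (ℕ.+-suc m r) ⟩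
  + ((suc m +ℕ r) C r) ∎
  where
  open ≡-Reasoning
  cancel : ∀ x y → x + y - y ≡ x
  cancel = ℤ-Ring.solve-∀

[1-x]·[1-x]^-[1+0] : [1-x]· [1-x]^-[1+ 0 ] ≗ 𝟙
[1-x]·[1-x]^-[1+0] zero    = refl
[1-x]·[1-x]^-[1+0] (suc m) = refl

[1-x]^[1+r]-⋆-x^-[1-x]^-[1+r] : ∀ r s → [1-x]^ suc r ⋆ (x^ s · [1-x]^-[1+ r ]) ≗ x^ s · 𝟙
[1-x]^[1+r]-⋆-x^-[1-x]^-[1+r] zero s k = begin
  ([1-x]^ 1 ⋆ (x^ s · [1-x]^-[1+ 0 ])) k          ≡⟨ [1-x]^-suc-⋆ 0 (x^ s · [1-x]^-[1+ 0 ]) k ⟩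
  ([1-x]^ 0 ⋆ ([1-x]· (x^ s · [1-x]^-[1+ 0 ]))) k ≡⟨ [1-x]^0-⋆ ([1-x]· (x^ s · [1-x]^-[1+ 0 ])) k ⟩
  ([1-x]· (x^ s · [1-x]^-[1+ 0 ])) k              ≡⟨ [1-x]·-x^ s [1-x]^-[1+ 0 ] k ⟩
  (x^ s · ([1-x]· [1-x]^-[1+ 0 ])) k              ≡⟨ x^-cong s [1-x]·[1-x]^-[1+0] k ⟩
  (x^ s · 𝟙) k                                    ∎
  where open ≡-Reasoning
[1-x]^[1+r]-⋆-x^-[1-x]^-[1+r] (suc r) s k = begin
  ([1-x]^ suc (suc r) ⋆ (x^ s · [1-x]^-[1+ suc r ])) k   ≡⟨ [1-x]^-suc-⋆ (suc r) (x^ s · [1-x]^-[1+ suc r ]) k ⟩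
  ([1-x]^ suc r ⋆ ([1-x]· (x^ s · [1-x]^-[1+ suc r ]))) k
    ≡⟨ ⋆-congʳ ([1-x]^ suc r) (λ m → trans ([1-x]·-x^ s [1-x]^-[1+ suc r ] m) (x^-cong s ([1-x]·[1-x]^-[1+suc] r) m)) k ⟩
  ([1-x]^ suc r ⋆ (x^ s · [1-x]^-[1+ r ])) k              ≡⟨ [1-x]^[1+r]-⋆-x^-[1-x]^-[1+r] r s k ⟩
  (x^ s · 𝟙) k                                           ∎
  where open ≡-Reasoning

⋆-zeroʳ : ∀ a → a ⋆ (λ _ → 0ℤ) ≗ λ _ → 0ℤ
⋆-zeroʳ a k = ∑-zero (suc k) (λ {j} _ → ℤ.*-zeroʳ (a j))

⋆-*ʳ : ∀ a c b → a ⋆ (λ m → c * b m) ≗ λ k → c * (a ⋆ b) k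
⋆-*ʳ a c b k = trans (∑-cong (suc k) (λ {j} _ → exchange (a j) c (b (k ∸ j)))) (∑-*ˡ (suc k) c _)
  where
  exchange : ∀ x y z → x * (y * z) ≡ y * (x * z)
  exchange = ℤ-Ring.solve-∀

⋆-+ʳ : ∀ a b c → a ⋆ (λ m → b m + c m) ≗ λ k → (a ⋆ b) k + (a ⋆ c) k
⋆-+ʳ a b c k = trans (∑-cong (suc k) (λ {j} _ → ℤ.*-distribˡ-+ (a j) (b (k ∸ j)) (c (k ∸ j)))) (∑-+ (suc k) _ _)

⋆-∑ʳ : ∀ a n (F : ℕ → Series) → a ⋆ (λ m → ∑[ i < n ] F i m) ≗ λ k → ∑[ i < n ] (a ⋆ F i) k
⋆-∑ʳ a n F k = trans (∑-cong (suc k) (λ {j} _ → sym (∑-*ˡ n (a j) (λ i → F i (k ∸ j))))) (∑-comm (suc k) n _)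

x^-below : ∀ {s k} a → k < s → (x^ s · a) k ≡ 0ℤ
x^-below {suc s} {zero}  a _         = refl
x^-below {suc s} {suc k} a (s≤s k<s) = x^-below a k<s

x^-+ : ∀ p {s} a k → (x^ (p +ℕ s) · a) (p +ℕ k) ≡ (x^ s · a) k
x^-+ zero    a k = refl
x^-+ (suc p) a k = x^-+ p a k

x^-𝟙-above : ∀ {s k} → s < k → (x^ s · 𝟙) k ≡ 0ℤ
x^-𝟙-above {zero}  {suc k} _         = refl
x^-𝟙-above {suc s} {suc k} (s≤s s<k) = x^-𝟙-above s<k

x^-𝟙-diagonal : ∀ k → (x^ k · 𝟙) k ≡ 1ℤ
x^-𝟙-diagonal zero    = refl
x^-𝟙-diagonal (suc k) = x^-𝟙-diagonal k

∑-x^-𝟙-beyond : ∀ {K t} (f : ℕ → ℤ) → K ≤ t → ∑[ i < K ] (f i * (x^ i · 𝟙) t) ≡ 0ℤ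
∑-x^-𝟙-beyond {K} f K≤t =
  ∑-zero K (λ {i} i<K → trans (cong (f i *_) (x^-𝟙-above (ℕ.<-≤-trans i<K K≤t))) (ℤ.*-zeroʳ (f i)))

∑-x^-𝟙 : ∀ {K t} (f : ℕ → ℤ) → t < K → ∑[ i < K ] (f i * (x^ i · 𝟙) t) ≡ f t
∑-x^-𝟙 {suc K} {t} f t<1+K with ℕ.m<1+n⇒m<n∨m≡n t<1+K
... | inj₁ t<K = begin
  ∑[ i < K ] (f i * (x^ i · 𝟙) t) + f K * (x^ K · 𝟙) t
    ≡⟨ cong₂ _+_ (∑-x^-𝟙 f t<K) (trans (cong (f K *_) (x^-below 𝟙 t<K)) (ℤ.*-zeroʳ (f K))) ⟩
  f t + 0ℤ ≡⟨ ℤ.+-identityʳ (f t) ⟩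
  f t      ∎
  where open ≡-Reasoning
... | inj₂ refl = begin
  ∑[ i < t ] (f i * (x^ i · 𝟙) t) + f t * (x^ t · 𝟙) t
    ≡⟨ cong₂ _+_ (∑-x^-𝟙-beyond {t} f ℕ.≤-refl) (trans (cong (f t *_) (x^-𝟙-diagonal t)) (ℤ.*-identityʳ (f t))) ⟩
  0ℤ + f t ≡⟨ ℤ.+-identityˡ (f t) ⟩
  f t      ∎
  where open ≡-Reasoning

x^-[1-x]^-[1+] : ∀ {s r} m → s ≤ r → (x^ s · [1-x]^-[1+ r ]) m ≡ + ((m +ℕ r ∸ s) C r)
x^-[1-x]^-[1+] {zero}          m       _   = refl
x^-[1-x]^-[1+] {suc s} {suc r} zero    _   = sym (cong +_ (k>n⇒nCk≡0 (s≤s (ℕ.m∸n≤m r s))))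
x^-[1-x]^-[1+] {suc s}         (suc m) s<r = x^-[1-x]^-[1+] m (ℕ.<⇒≤ s<r)

-- Evaluating polynomials

eval : Poly → ℤ → ℤ
eval []       x = 0ℤ
eval (c ∷ cs) x = c + x * eval cs x

eval-⊕ : ∀ P Q x → eval (P ⊕ Q) x ≡ eval P x + eval Q x
eval-⊕ []      Q       x = sym (ℤ.+-identityˡ (eval Q x))
eval-⊕ (a ∷ P) []      x = sym (ℤ.+-identityʳ (eval (a ∷ P) x))
eval-⊕ (a ∷ P) (b ∷ Q) x =
  trans (cong (λ t → a + b + x * t) (eval-⊕ P Q x)) (regroup a b x (eval P x) (eval Q x))
  where
  regroup : ∀ a b x u w → a + b + x * (u + w) ≡ a + x * u + (b + x * w)
  regroup = ℤ-Ring.solve-∀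

eval-scale : ∀ c P x → eval (scale c P) x ≡ c * eval P x
eval-scale c []      x = sym (ℤ.*-zeroʳ c)
eval-scale c (a ∷ P) x =
  trans (cong (λ t → c * a + x * t) (eval-scale c P x)) (regroup c a x (eval P x))
  where
  regroup : ∀ c a x u → c * a + x * (c * u) ≡ c * (a + x * u)
  regroup = ℤ-Ring.solve-∀

eval-⊛ : ∀ P Q x → eval (P ⊛ Q) x ≡ eval P x * eval Q x
eval-⊛ []      Q x = refl
eval-⊛ (a ∷ P) Q x = begin
  eval (scale a Q ⊕ (0ℤ ∷ (P ⊛ Q))) x
    ≡⟨ eval-⊕ (scale a Q) (0ℤ ∷ (P ⊛ Q)) x ⟩
  eval (scale a Q) x + (0ℤ + x * eval (P ⊛ Q) x)
    ≡⟨ cong₂ (λ s t → s + (0ℤ + x * t)) (eval-scale a Q x) (eval-⊛ P Q x) ⟩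
  a * eval Q x + (0ℤ + x * (eval P x * eval Q x))
    ≡⟨ regroup a x (eval P x) (eval Q x) ⟩
  (a + x * eval P x) * eval Q x ∎
  where
  open ≡-Reasoning
  regroup : ∀ a x u w → a * w + (0ℤ + x * (u * w)) ≡ (a + x * u) * w
  regroup = ℤ-Ring.solve-∀

eval-xPlus : ∀ c x → eval (xPlus c) x ≡ c + x
eval-xPlus c x = simplify c x
  where
  simplify : ∀ c x → c + x * (1ℤ + x * 0ℤ) ≡ c + x
  simplify = ℤ-Ring.solve-∀

eval-1 : ∀ x → eval (1ℤ ∷ []) x ≡ 1ℤ
eval-1 x = trans (cong (λ t → 1ℤ + t) (ℤ.*-zeroʳ x)) (ℤ.+-identityʳ 1ℤ)

eval-falling : ∀ p m → eval (falling p) (+ m) ≡ + (m P′ p)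
eval-falling zero    m = eval-1 (+ m)
eval-falling (suc p) m = begin
  eval (falling p ⊛ xPlus (- + p)) (+ m)        ≡⟨ eval-⊛ (falling p) (xPlus (- + p)) (+ m) ⟩
  eval (falling p) (+ m) * eval (xPlus (- + p)) (+ m)
    ≡⟨ cong₂ _*_ (eval-falling p m) (trans (eval-xPlus (- + p) (+ m)) (ℤ.-m+n≡n⊖m p m)) ⟩
  + (m P′ p) * (m ⊖ p)                          ≡⟨ last-factor (p ℕ.≤? m) ⟩
  + ((m ∸ p) *ℕ (m P′ p))                       ∎
  where
  open ≡-Reasoning
  last-factor : Dec (p ≤ m) → + (m P′ p) * (m ⊖ p) ≡ + ((m ∸ p) *ℕ (m P′ p))
  last-factor (yes p≤m) = begin
    + (m P′ p) * (m ⊖ p)          ≡⟨ cong (+ (m P′ p) *_) (ℤ.⊖-≥ p≤m) ⟩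
    + (m P′ p) * + (m ∸ p)        ≡⟨ ℤ.pos-* (m P′ p) (m ∸ p) ⟨
    + ((m P′ p) *ℕ (m ∸ p))       ≡⟨ cong +_ (ℕ.*-comm (m P′ p) (m ∸ p)) ⟩
    + ((m ∸ p) *ℕ (m P′ p))       ∎
  last-factor (no p≰m) rewrite k>n⇒nP′k≡0 (ℕ.≰⇒> p≰m) = cong +_ (sym (ℕ.*-zeroʳ (m ∸ p)))

eval-risingX1 : ∀ q m → eval (risingX1 q) (+ m) ≡ + ((m +ℕ q) P′ q)
eval-risingX1 zero    m = eval-1 (+ m)
eval-risingX1 (suc q) m = begin
  eval (risingX1 q ⊛ xPlus (+ suc q)) (+ m)       ≡⟨ eval-⊛ (risingX1 q) (xPlus (+ suc q)) (+ m) ⟩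
  eval (risingX1 q) (+ m) * eval (xPlus (+ suc q)) (+ m)
    ≡⟨ cong₂ _*_ (eval-risingX1 q m) (trans (eval-xPlus (+ suc q) (+ m)) (sym (ℤ.pos-+ (suc q) m))) ⟩
  + ((m +ℕ q) P′ q) * + (suc q +ℕ m)              ≡⟨ ℤ.pos-* ((m +ℕ q) P′ q) (suc q +ℕ m) ⟨
  + (((m +ℕ q) P′ q) *ℕ (suc q +ℕ m))             ≡⟨ cong +_ top-factor ⟩
  + ((m +ℕ suc q) P′ suc q)                       ∎
  where
  open ≡-Reasoning
  top-factor : ((m +ℕ q) P′ q) *ℕ (suc q +ℕ m) ≡ (m +ℕ suc q) P′ suc q
  top-factor = begin
    ((m +ℕ q) P′ q) *ℕ (suc q +ℕ m)   ≡⟨ cong (λ t → ((m +ℕ q) P′ q) *ℕ suc t) (ℕ.+-comm q m) ⟩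
    ((m +ℕ q) P′ q) *ℕ suc (m +ℕ q)   ≡⟨ ℕ.*-comm ((m +ℕ q) P′ q) (suc (m +ℕ q)) ⟩
    suc (m +ℕ q) *ℕ ((m +ℕ q) P′ q)   ≡⟨ nP′k≡n[n∸1P′k∸1] (suc (m +ℕ q)) (suc q) ⟨
    (suc (m +ℕ q) P′ suc q)           ≡⟨ cong (_P′ suc q) (ℕ.+-suc m q) ⟨
    (m +ℕ suc q) P′ suc q             ∎

eval-Uinv : ∀ {n p} m → p ≤ n → eval (Uinv n p) (+ m) ≡ + (n ! *ℕ ((m +ℕ (n ∸ p)) C n))
eval-Uinv {n} {p} m p≤n = begin
  eval (falling p ⊛ risingX1 q) (+ m)                   ≡⟨ eval-⊛ (falling p) (risingX1 q) (+ m) ⟩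
  eval (falling p) (+ m) * eval (risingX1 q) (+ m)      ≡⟨ cong₂ _*_ (eval-falling p m) (eval-risingX1 q m) ⟩
  + (m P′ p) * + ((m +ℕ q) P′ q)                        ≡⟨ ℤ.pos-* (m P′ p) ((m +ℕ q) P′ q) ⟨
  + ((m P′ p) *ℕ ((m +ℕ q) P′ q))                       ≡⟨ cong (λ t → + ((t P′ p) *ℕ ((m +ℕ q) P′ q))) (ℕ.m+n∸n≡m m q) ⟨
  + (((m +ℕ q ∸ q) P′ p) *ℕ ((m +ℕ q) P′ q))            ≡⟨ cong +_ (nP′[k+l]≡[n∸l]P′k*nP′l (m +ℕ q) p q) ⟨
  + ((m +ℕ q) P′ (p +ℕ q))                              ≡⟨ cong (λ k → + ((m +ℕ q) P′ k)) (ℕ.m+[n∸m]≡n p≤n) ⟩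
  + ((m +ℕ q) P′ n)                                     ≡⟨ cong +_ (nP′k≡k!*nCk (m +ℕ q) n) ⟩
  + (n ! *ℕ ((m +ℕ q) C n))                             ∎
  where
  open ≡-Reasoning
  q = n ∸ p

-- The operator F_n

-- The coefficient of x^k in F_n (x^q P), i.e. the local `go` of `Fcoeff` (which starts at q = 0).
Fcoeff-from : ℕ → ℕ → ℕ → Poly → ℤ
Fcoeff-from n k q []       = 0ℤ
Fcoeff-from n k q (c ∷ cs) = c * Fmono n q k + Fcoeff-from n k (suc q) cs

Fcoeff-from-unique : ∀ n k (g : ℕ → Poly → ℤ) → (∀ q → g q [] ≡ 0ℤ) →
  (∀ q c cs → g q (c ∷ cs) ≡ c * Fmono n q k + g (suc q) cs) →
  ∀ q P → g q P ≡ Fcoeff-from n k q P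
Fcoeff-from-unique n k g g[] g∷ q []       = g[] q
Fcoeff-from-unique n k g g[] g∷ q (c ∷ cs) =
  trans (g∷ q c cs) (cong (λ t → c * Fmono n q k + t) (Fcoeff-from-unique n k g g[] g∷ (suc q) cs))

Fcoeff≡Fcoeff-from : ∀ n k P → Fcoeff n P k ≡ Fcoeff-from n k 0 P
Fcoeff≡Fcoeff-from n k []       = refl
-- `go` cannot be named, so the `with`s abstract its arguments until it is a pattern solution for `g`.
Fcoeff≡Fcoeff-from n k (c ∷ cs) with c * Fmono n 0 k
... | head with c ∷ cs
... | _ with Fcoeff-from-unique n k _ (λ _ → refl) (λ _ _ _ → refl) | 1 | cs
... | go≗Fcoeff-from | one | tail = cong (λ t → head + t) (go≗Fcoeff-from one tail)

Fmono≡⋆ : ∀ n q k → Fmono n q k ≡ ([1-x]^ (2 *ℕ n +ℕ 1) ⋆ (λ m → + (m ^ℕ q *ℕ ((m +ℕ n) C n)))) k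
Fmono≡⋆ n q k = sumTo≡∑ (suc k) _

Fcoeff-from-⋆ : ∀ n k q P →
  Fcoeff-from n k q P ≡ ([1-x]^ (2 *ℕ n +ℕ 1) ⋆ (λ m → + (m ^ℕ q) * eval P (+ m) * + ((m +ℕ n) C n))) k
Fcoeff-from-⋆ n k q [] = sym (trans (⋆-congʳ E vanish k) (⋆-zeroʳ E k))
  where
  E = [1-x]^ (2 *ℕ n +ℕ 1)
  vanish : ∀ m → + (m ^ℕ q) * 0ℤ * + ((m +ℕ n) C n) ≡ 0ℤ
  vanish m = cong (_* + ((m +ℕ n) C n)) (ℤ.*-zeroʳ (+ (m ^ℕ q)))
Fcoeff-from-⋆ n k q (c ∷ cs) = begin
  c * Fmono n q k + Fcoeff-from n k (suc q) cs
    ≡⟨ cong₂ (λ s t → c * s + t) (Fmono≡⋆ n q k) (Fcoeff-from-⋆ n k (suc q) cs) ⟩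
  c * (E ⋆ g) k + (E ⋆ h) k           ≡⟨ cong (_+ (E ⋆ h) k) (⋆-*ʳ E c g k) ⟨
  (E ⋆ (λ m → c * g m)) k + (E ⋆ h) k ≡⟨ ⋆-+ʳ E (λ m → c * g m) h k ⟨
  (E ⋆ (λ m → c * g m + h m)) k       ≡⟨ ⋆-congʳ E term k ⟩
  (E ⋆ (λ m → + (m ^ℕ q) * eval (c ∷ cs) (+ m) * + ((m +ℕ n) C n))) k ∎
  where
  open ≡-Reasoning
  E = [1-x]^ (2 *ℕ n +ℕ 1)
  g h : Series
  g m = + (m ^ℕ q *ℕ ((m +ℕ n) C n))
  h m = + (m ^ℕ suc q) * eval cs (+ m) * + ((m +ℕ n) C n)
  horner : ∀ c m′ x e b → c * (x * b) + m′ * x * e * b ≡ x * (c + m′ * e) * b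
  horner = ℤ-Ring.solve-∀
  term : ∀ m → c * g m + h m ≡ + (m ^ℕ q) * eval (c ∷ cs) (+ m) * + ((m +ℕ n) C n)
  term m = trans (cong₂ (λ s t → c * s + t * eval cs (+ m) * + ((m +ℕ n) C n))
                        (ℤ.pos-* (m ^ℕ q) ((m +ℕ n) C n)) (ℤ.pos-* m (m ^ℕ q)))
                 (horner c (+ m) (+ (m ^ℕ q)) (eval cs (+ m)) (+ ((m +ℕ n) C n)))

-- The coefficients of S_n x^p

S-coefficient : ℕ → ℕ → ℕ → ℕ
S-coefficient n p i = ((n ∸ p) C i) *ℕ ((n +ℕ p) C (n ∸ i))

m+[n∸p]+[n∸i]≡m+[n+n]∸[p+i] : ∀ m {n p i} → p +ℕ i ≤ n →
  m +ℕ (n ∸ p) +ℕ (n ∸ i) ≡ m +ℕ (n +ℕ n) ∸ (p +ℕ i)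
m+[n∸p]+[n∸i]≡m+[n+n]∸[p+i] m {n} {p} {i} p+i≤n = begin
  L                          ≡⟨ ℕ.m+n∸n≡m L (p +ℕ i) ⟨
  L +ℕ (p +ℕ i) ∸ (p +ℕ i)   ≡⟨ cong (_∸ (p +ℕ i)) L+p+i≡m+[n+n] ⟩
  m +ℕ (n +ℕ n) ∸ (p +ℕ i)   ∎
  where
  open ≡-Reasoning
  L = m +ℕ (n ∸ p) +ℕ (n ∸ i)
  regroup : ∀ m a b p i → m +ℕ a +ℕ b +ℕ (p +ℕ i) ≡ m +ℕ ((a +ℕ p) +ℕ (b +ℕ i))
  regroup = ℕ-Ring.solve-∀
  L+p+i≡m+[n+n] : L +ℕ (p +ℕ i) ≡ m +ℕ (n +ℕ n)
  L+p+i≡m+[n+n] = trans (regroup m (n ∸ p) (n ∸ i) p i)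
    (cong₂ (λ x y → m +ℕ (x +ℕ y)) (ℕ.m∸n+n≡m (ℕ.m+n≤o⇒m≤o p p+i≤n))
                                   (ℕ.m∸n+n≡m (ℕ.m+n≤o⇒n≤o p p+i≤n)))

expansion-term-as-shift : ∀ {n p} → p ≤ n → ∀ m i →
  + (((n ∸ p) C i) *ℕ (((n +ℕ p) C (n ∸ i)) *ℕ ((m +ℕ (n ∸ p) +ℕ (n ∸ i)) C (n +ℕ n))))
    ≡ + (S-coefficient n p i) * (x^ (p +ℕ i) · [1-x]^-[1+ n +ℕ n ]) m
expansion-term-as-shift {n} {p} p≤n m i with i ℕ.≤? n ∸ p
... | no i≰n∸p rewrite k>n⇒nCk≡0 (ℕ.≰⇒> i≰n∸p) = refl
... | yes i≤n∸p = begin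
  + (a *ℕ (b *ℕ W))      ≡⟨ cong +_ (ℕ.*-assoc a b W) ⟨
  + (a *ℕ b *ℕ W)        ≡⟨ ℤ.pos-* (a *ℕ b) W ⟩
  + (a *ℕ b) * + W
    ≡⟨ cong (λ t → + (a *ℕ b) * + (t C (n +ℕ n))) (m+[n∸p]+[n∸i]≡m+[n+n]∸[p+i] m {n} {p} {i} p+i≤n) ⟩
  + (a *ℕ b) * + ((m +ℕ (n +ℕ n) ∸ (p +ℕ i)) C (n +ℕ n))
    ≡⟨ cong (+ (a *ℕ b) *_) (x^-[1-x]^-[1+] m (ℕ.≤-trans p+i≤n (ℕ.m≤m+n n n))) ⟨
  + (a *ℕ b) * (x^ (p +ℕ i) · [1-x]^-[1+ n +ℕ n ]) m ∎
  where
  open ≡-Reasoning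
  a = (n ∸ p) C i
  b = (n +ℕ p) C (n ∸ i)
  W = (m +ℕ (n ∸ p) +ℕ (n ∸ i)) C (n +ℕ n)
  p+i≤n : p +ℕ i ≤ n
  p+i≤n = ℕ.≤-trans (ℕ.+-monoʳ-≤ p i≤n∸p) (ℕ.≤-reflexive (ℕ.m+[n∸m]≡n p≤n))

Uinv-series : ∀ {n p} → p ≤ n → ∀ m →
  + (m ^ℕ 0) * eval (Uinv n p) (+ m) * + ((m +ℕ n) C n)
    ≡ + (n !) * ∑[ i < suc n ] (+ (S-coefficient n p i) * (x^ (p +ℕ i) · [1-x]^-[1+ n +ℕ n ]) m)
Uinv-series {n} {p} p≤n m = begin
  + 1 * eval (Uinv n p) (+ m) * + ((m +ℕ n) C n)
    ≡⟨ cong (λ t → t * + ((m +ℕ n) C n)) (trans (ℤ.*-identityˡ _) (eval-Uinv m p≤n)) ⟩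
  + (n ! *ℕ (v C n)) * + ((m +ℕ n) C n)        ≡⟨ ℤ.pos-* (n ! *ℕ (v C n)) ((m +ℕ n) C n) ⟨
  + (n ! *ℕ (v C n) *ℕ ((m +ℕ n) C n))         ≡⟨ cong +_ (regroup (n !) (v C n) ((m +ℕ n) C n)) ⟩
  + (n ! *ℕ (((m +ℕ n) C n) *ℕ (v C n)))       ≡⟨ cong (λ t → + (n ! *ℕ ((t C n) *ℕ (v C n)))) v+p≡m+n ⟨
  + (n ! *ℕ (((v +ℕ p) C n) *ℕ (v C n)))       ≡⟨ cong (λ t → + (n ! *ℕ t)) (binomial-product-expansion v n p≤n) ⟩
  + (n ! *ℕ expansion p n n v)                 ≡⟨ ℤ.pos-* (n !) (expansion p n n v) ⟩
  + (n !) * + expansion p n n v                ≡⟨ cong (+ (n !) *_) (+-∑ (suc n) _) ⟩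
  + (n !) * ∑[ i < suc n ] (+ (((n ∸ p) C i) *ℕ (((n +ℕ p) C (n ∸ i)) *ℕ ((v +ℕ (n ∸ i)) C (n +ℕ n)))))
    ≡⟨ cong (+ (n !) *_) (∑-cong (suc n) (λ {i} _ → expansion-term-as-shift p≤n m i)) ⟩
  + (n !) * ∑[ i < suc n ] (+ (S-coefficient n p i) * (x^ (p +ℕ i) · [1-x]^-[1+ n +ℕ n ]) m) ∎
  where
  open ≡-Reasoning
  open BinomialProductExpansion using (expansion; binomial-product-expansion)
  v = m +ℕ (n ∸ p)
  v+p≡m+n : v +ℕ p ≡ m +ℕ n
  v+p≡m+n = trans (ℕ.+-assoc m (n ∸ p) p) (cong (m +ℕ_) (ℕ.m∸n+n≡m p≤n))
  regroup : ∀ a b c → a *ℕ b *ℕ c ≡ a *ℕ (c *ℕ b)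
  regroup = ℕ-Ring.solve-∀

Scoeff-as-∑ : ∀ {n p} → p ≤ n → ∀ k →
  Scoeff n p k ≡ + (n !) * ∑[ i < suc n ] (+ (S-coefficient n p i) * (x^ (p +ℕ i) · 𝟙) k)
Scoeff-as-∑ {n} {p} p≤n k = begin
  Fcoeff n (Uinv n p) k                  ≡⟨ Fcoeff≡Fcoeff-from n k (Uinv n p) ⟩
  Fcoeff-from n k 0 (Uinv n p)           ≡⟨ Fcoeff-from-⋆ n k 0 (Uinv n p) ⟩
  (E ⋆ (λ m → + (m ^ℕ 0) * eval (Uinv n p) (+ m) * + ((m +ℕ n) C n))) k
                                         ≡⟨ ⋆-congʳ E (Uinv-series p≤n) k ⟩
  (E ⋆ (λ m → + (n !) * ∑[ i < suc n ] G i m)) k ≡⟨ ⋆-*ʳ E (+ (n !)) (λ m → ∑[ i < suc n ] G i m) k ⟩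
  + (n !) * (E ⋆ (λ m → ∑[ i < suc n ] G i m)) k ≡⟨ cong (+ (n !) *_) (⋆-∑ʳ E (suc n) G k) ⟩
  + (n !) * ∑[ i < suc n ] (E ⋆ G i) k   ≡⟨ cong (+ (n !) *_) (∑-cong (suc n) (λ {i} _ → extract i)) ⟩
  + (n !) * ∑[ i < suc n ] (+ (S-coefficient n p i) * (x^ (p +ℕ i) · 𝟙) k) ∎
  where
  open ≡-Reasoning
  E = [1-x]^ (2 *ℕ n +ℕ 1)
  G : ℕ → Series
  G i m = + (S-coefficient n p i) * (x^ (p +ℕ i) · [1-x]^-[1+ n +ℕ n ]) m
  2n+1≡1+[n+n] : ∀ n → 2 *ℕ n +ℕ 1 ≡ suc (n +ℕ n)
  2n+1≡1+[n+n] = ℕ-Ring.solve-∀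
  extract : ∀ i → (E ⋆ G i) k ≡ + (S-coefficient n p i) * (x^ (p +ℕ i) · 𝟙) k
  extract i = trans (⋆-*ʳ E (+ (S-coefficient n p i)) (x^ (p +ℕ i) · [1-x]^-[1+ n +ℕ n ]) k)
    (cong (+ (S-coefficient n p i) *_)
      (trans (cong (λ N → ([1-x]^ N ⋆ (x^ (p +ℕ i) · [1-x]^-[1+ n +ℕ n ])) k) (2n+1≡1+[n+n] n))
             ([1-x]^[1+r]-⋆-x^-[1-x]^-[1+r] (n +ℕ n) (p +ℕ i) k)))

Scoeff-below : ∀ {n p k} → p ≤ n → k < p → Scoeff n p k ≡ 0ℤ
Scoeff-below {n} {p} {k} p≤n k<p = begin
  Scoeff n p k                                                              ≡⟨ Scoeff-as-∑ p≤n k ⟩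
  + (n !) * ∑[ i < suc n ] (+ (S-coefficient n p i) * (x^ (p +ℕ i) · 𝟙) k) ≡⟨ cong (+ (n !) *_) (∑-zero (suc n) vanish) ⟩
  + (n !) * 0ℤ                                                              ≡⟨ ℤ.*-zeroʳ (+ (n !)) ⟩
  0ℤ                                                                        ∎
  where
  open ≡-Reasoning
  vanish : ∀ {i} → i < suc n → + (S-coefficient n p i) * (x^ (p +ℕ i) · 𝟙) k ≡ 0ℤ
  vanish {i} _ = trans (cong (+ (S-coefficient n p i) *_) (x^-below 𝟙 (ℕ.<-≤-trans k<p (ℕ.m≤m+n p i))))
                       (ℤ.*-zeroʳ (+ (S-coefficient n p i)))

Scoeff-shifted : ∀ {n p} → p ≤ n → ∀ t →
  Scoeff n p (p +ℕ t) ≡ + (n !) * ∑[ i < suc n ] (+ (S-coefficient n p i) * (x^ i · 𝟙) t)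
Scoeff-shifted {n} {p} p≤n t = trans (Scoeff-as-∑ p≤n (p +ℕ t))
  (cong (+ (n !) *_) (∑-cong (suc n) (λ {i} _ → cong (+ (S-coefficient n p i) *_) (x^-+ p 𝟙 t))))

Scoeff-inside : ∀ {n p k} → p ≤ n → p ≤ k → k ≤ n → Scoeff n p k ≡ + (n !) * + S-coefficient n p (k ∸ p)
Scoeff-inside {n} {p} p≤n p≤k k≤n with ℕ.m≤n⇒∃[o]m+o≡n p≤k
... | t , refl = begin
  Scoeff n p (p +ℕ t)                     ≡⟨ Scoeff-shifted p≤n t ⟩
  + (n !) * ∑[ i < suc n ] (+ (S-coefficient n p i) * (x^ i · 𝟙) t)
    ≡⟨ cong (+ (n !) *_) (∑-x^-𝟙 (λ i → + (S-coefficient n p i)) (s≤s (ℕ.m+n≤o⇒n≤o p k≤n))) ⟩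
  + (n !) * + S-coefficient n p t          ≡⟨ cong (λ j → + (n !) * + S-coefficient n p j) (ℕ.m+n∸m≡n p t) ⟨
  + (n !) * + S-coefficient n p (p +ℕ t ∸ p) ∎
  where open ≡-Reasoning

Scoeff-above : ∀ {n p k} → p ≤ n → p ≤ k → n < k → Scoeff n p k ≡ 0ℤ
Scoeff-above {n} {p} p≤n p≤k n<k with ℕ.m≤n⇒∃[o]m+o≡n p≤k
... | t , refl = trans (Scoeff-shifted p≤n t) (trans (cong (+ (n !) *_) (extract (t ℕ.<? suc n))) (ℤ.*-zeroʳ (+ (n !))))
  where
  n∸p<t : n ∸ p < t
  n∸p<t = subst (_≤ t) (ℕ.+-∸-assoc 1 p≤n) (ℕ.m≤n+o⇒m∸n≤o (suc n) p n<k)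
  extract : Dec (t < suc n) → ∑[ i < suc n ] (+ (S-coefficient n p i) * (x^ i · 𝟙) t) ≡ 0ℤ
  extract (yes t<1+n) = trans (∑-x^-𝟙 (λ i → + (S-coefficient n p i)) t<1+n)
                              (cong (λ c → + (c *ℕ ((n +ℕ p) C (n ∸ t)))) (k>n⇒nCk≡0 n∸p<t))
  extract (no t≮1+n)  = ∑-x^-𝟙-beyond (λ i → + (S-coefficient n p i)) (ℕ.≮⇒≥ t≮1+n)

S-coefficient-factorials′ : ∀ p t e → let n = p +ℕ (t +ℕ e) in
  n ! *ℕ (n ! *ℕ (((t +ℕ e) C t) *ℕ ((n +ℕ p) C (n ∸ t)))) ≡ ((n +ℕ p) ! *ℕ (t +ℕ e) !) *ℕ ((n C t) *ℕ (n C e))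
S-coefficient-factorials′ p t e = ℕ.*-cancelʳ-≡ _ _ F (trans lhs (sym rhs))
  where
  open ≡-Reasoning
  n = p +ℕ (t +ℕ e)
  F = t ! *ℕ (e ! *ℕ ((p +ℕ e) ! *ℕ (p +ℕ t) !))
  instance _ = ℕ.m*n≢0 (t !) _ {{ℕ._!≢0 t}} {{ℕ.m*n≢0 (e !) _ {{ℕ._!≢0 e}} {{ℕ._!*_!≢0 (p +ℕ e) (p +ℕ t)}}}}
  sum₁ : ∀ p t e → t +ℕ (p +ℕ e) ≡ p +ℕ (t +ℕ e)
  sum₁ = ℕ-Ring.solve-∀
  sum₂ : ∀ p t e → p +ℕ e +ℕ (p +ℕ t) ≡ p +ℕ (t +ℕ e) +ℕ p
  sum₂ = ℕ-Ring.solve-∀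
  sum₃ : ∀ p t e → e +ℕ (p +ℕ t) ≡ p +ℕ (t +ℕ e)
  sum₃ = ℕ-Ring.solve-∀
  regroupˡ : ∀ N A B ft fe fpe fk →
    N *ℕ (N *ℕ (A *ℕ B)) *ℕ (ft *ℕ (fe *ℕ (fpe *ℕ fk)))
      ≡ N *ℕ N *ℕ (A *ℕ (ft *ℕ fe) *ℕ (B *ℕ (fpe *ℕ fk)))
  regroupˡ = ℕ-Ring.solve-∀
  regroupʳ : ∀ NP TE X Y ft fe fpe fk →
    NP *ℕ TE *ℕ (X *ℕ Y) *ℕ (ft *ℕ (fe *ℕ (fpe *ℕ fk)))
      ≡ X *ℕ (ft *ℕ fpe) *ℕ (Y *ℕ (fe *ℕ fk)) *ℕ (TE *ℕ NP)
  regroupʳ = ℕ-Ring.solve-∀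
  n∸t≡p+e : n ∸ t ≡ p +ℕ e
  n∸t≡p+e = trans (ℕ.+-∸-assoc p (ℕ.m≤m+n t e)) (cong (p +ℕ_) (ℕ.m+n∸m≡n t e))
  lhs : n ! *ℕ (n ! *ℕ (((t +ℕ e) C t) *ℕ ((n +ℕ p) C (n ∸ t)))) *ℕ F ≡ n ! *ℕ n ! *ℕ ((t +ℕ e) ! *ℕ (n +ℕ p) !)
  lhs = begin
    n ! *ℕ (n ! *ℕ (((t +ℕ e) C t) *ℕ ((n +ℕ p) C (n ∸ t)))) *ℕ F
      ≡⟨ cong (λ j → n ! *ℕ (n ! *ℕ (((t +ℕ e) C t) *ℕ ((n +ℕ p) C j))) *ℕ F) n∸t≡p+e ⟩
    n ! *ℕ (n ! *ℕ (((t +ℕ e) C t) *ℕ ((n +ℕ p) C (p +ℕ e)))) *ℕ F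
      ≡⟨ regroupˡ (n !) ((t +ℕ e) C t) ((n +ℕ p) C (p +ℕ e)) (t !) (e !) ((p +ℕ e) !) ((p +ℕ t) !) ⟩
    n ! *ℕ n ! *ℕ (((t +ℕ e) C t) *ℕ (t ! *ℕ e !) *ℕ (((n +ℕ p) C (p +ℕ e)) *ℕ ((p +ℕ e) ! *ℕ (p +ℕ t) !)))
      ≡⟨ cong₂ (λ x y → n ! *ℕ n ! *ℕ (x *ℕ y)) (nCk*k!*l!≡n! t e refl)
               (nCk*k!*l!≡n! (p +ℕ e) (p +ℕ t) (sum₂ p t e)) ⟩
    n ! *ℕ n ! *ℕ ((t +ℕ e) ! *ℕ (n +ℕ p) !) ∎
  rhs : ((n +ℕ p) ! *ℕ (t +ℕ e) !) *ℕ ((n C t) *ℕ (n C e)) *ℕ F ≡ n ! *ℕ n ! *ℕ ((t +ℕ e) ! *ℕ (n +ℕ p) !)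
  rhs = begin
    ((n +ℕ p) ! *ℕ (t +ℕ e) !) *ℕ ((n C t) *ℕ (n C e)) *ℕ F
      ≡⟨ regroupʳ ((n +ℕ p) !) ((t +ℕ e) !) (n C t) (n C e) (t !) (e !) ((p +ℕ e) !) ((p +ℕ t) !) ⟩
    (n C t) *ℕ (t ! *ℕ (p +ℕ e) !) *ℕ ((n C e) *ℕ (e ! *ℕ (p +ℕ t) !)) *ℕ ((t +ℕ e) ! *ℕ (n +ℕ p) !)
      ≡⟨ cong₂ (λ x y → x *ℕ y *ℕ ((t +ℕ e) ! *ℕ (n +ℕ p) !))
               (nCk*k!*l!≡n! t (p +ℕ e) (sum₁ p t e)) (nCk*k!*l!≡n! e (p +ℕ t) (sum₃ p t e)) ⟩
    n ! *ℕ n ! *ℕ ((t +ℕ e) ! *ℕ (n +ℕ p) !) ∎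

S-coefficient-factorials : ∀ {n p k} → p ≤ k → k ≤ n →
  n ! *ℕ (n ! *ℕ S-coefficient n p (k ∸ p)) ≡ ((n +ℕ p) ! *ℕ (n ∸ p) !) *ℕ ((n C (k ∸ p)) *ℕ (n C (n ∸ k)))
S-coefficient-factorials {p = p} p≤k k≤n with ℕ.m≤n⇒∃[o]m+o≡n p≤k
... | t , refl with ℕ.m≤n⇒∃[o]m+o≡n k≤n
... | e , refl
  rewrite ℕ.m+n∸m≡n p t | ℕ.m+n∸m≡n (p +ℕ t) e | ℕ.+-assoc p t e | ℕ.m+n∸m≡n p (t +ℕ e)
  = S-coefficient-factorials′ p t e

rhsCoeff-below : ∀ n {p k} → ¬ p ≤ k → rhsCoeff n p k ≡ 0ℤ
rhsCoeff-below n {p} {k} p≰k rewrite dec-false (p ℕ.≤? k) p≰k = refl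

rhsCoeff-above : ∀ {n} p {k} → ¬ k ≤ n → rhsCoeff n p k ≡ 0ℤ
rhsCoeff-above {n} p {k} k≰n rewrite dec-false (k ℕ.≤? n) k≰n | ∧-zeroʳ (p ≤ᵇ k) = refl

rhsCoeff-inside : ∀ {n p k} → p ≤ k → k ≤ n → rhsCoeff n p k ≡ + ((n C (k ∸ p)) *ℕ (n C (n ∸ k)))
rhsCoeff-inside {n} {p} {k} p≤k k≤n rewrite dec-true (p ℕ.≤? k) p≤k | dec-true (k ℕ.≤? n) k≤n = refl

theorem4p2 : (n p : ℕ) → p ≤ n → (k : ℕ) →
    (+ (n !)) * Scoeff n p k ≡ (+ (((n +ℕ p) !) *ℕ ((n ∸ p) !))) * rhsCoeff n p k
theorem4p2 n p p≤n k = by-cases (p ℕ.≤? k) (k ℕ.≤? n)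
  where
  open ≡-Reasoning
  X = (n +ℕ p) ! *ℕ (n ∸ p) !
  both-vanish : ∀ {s r} → s ≡ 0ℤ → r ≡ 0ℤ → + (n !) * s ≡ + X * r
  both-vanish refl refl = trans (ℤ.*-zeroʳ (+ (n !))) (sym (ℤ.*-zeroʳ (+ X)))
  by-cases : Dec (p ≤ k) → Dec (k ≤ n) → + (n !) * Scoeff n p k ≡ + X * rhsCoeff n p k
  by-cases (no p≰k)  _         = both-vanish (Scoeff-below p≤n (ℕ.≰⇒> p≰k)) (rhsCoeff-below n p≰k)
  by-cases (yes p≤k) (no k≰n)  = both-vanish (Scoeff-above p≤n p≤k (ℕ.≰⇒> k≰n)) (rhsCoeff-above p k≰n)
  by-cases (yes p≤k) (yes k≤n) = begin
    + (n !) * Scoeff n p k                            ≡⟨ cong (+ (n !) *_) (Scoeff-inside p≤n p≤k k≤n) ⟩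
    + (n !) * (+ (n !) * + S-coefficient n p (k ∸ p)) ≡⟨ cong (+ (n !) *_) (ℤ.pos-* (n !) _) ⟨
    + (n !) * + (n ! *ℕ S-coefficient n p (k ∸ p))    ≡⟨ ℤ.pos-* (n !) _ ⟨
    + (n ! *ℕ (n ! *ℕ S-coefficient n p (k ∸ p)))     ≡⟨ cong +_ (S-coefficient-factorials p≤k k≤n) ⟩
    + (X *ℕ ((n C (k ∸ p)) *ℕ (n C (n ∸ k))))         ≡⟨ ℤ.pos-* X _ ⟩
    + X * + ((n C (k ∸ p)) *ℕ (n C (n ∸ k)))          ≡⟨ cong (+ X *_) (rhsCoeff-inside p≤k k≤n) ⟨
    + X * rhsCoeff n p k                              ∎
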